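{- Let $G$ be a trapezoid graph with $n$ vertices. Then $\mathrm{boolw}(G)\le 2\log_2 n$.
   Context: A trapezoid graph is the intersection graph of trapezoids between two parallel lines, each trapezoid being determined by an interval on the upper line and an interval on the lower line. For $A\subseteq V(G)$ write $\overline{A}=V(G)\setminus A$. A decomposition tree of $G$ is a pair $(T,\delta)$ where $T$ is a tree whose internal nodes have degree three and which has $|V(G)|$ leaves, and $\delta$ is a bijection between $V(G)$ and the leaves of $T$; each edge of $T$ defines a cut $\{A,\overline{A}\}$ given by the leaves of the two components of $T$ minus that edge. Define $\mathrm{cut\text{ - }bool}(A)=\log_2|\{S\subseteq\overline{A} : \exists X\subseteq A,\ S=\overline{A}\cap\bigcup_{x\in X}N(x)\}|$. The boolean-width of $(T,\delta)$ is the maximum of $\mathrm{cut\text{ - }bool}(A)$ over cuts given by edges of $T$, and $\mathrm{boolw}(G)$ is the minimum over all decomposition trees of $G$.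
   Formalization: The trapezoids representing the vertices of G have rational endpoints on both parallel lines. -}

module Defs where

open import Data.Nat using (ℕ; zero; suc; _≤_; _^_)
open import Data.Bool using (Bool; true; false; _∧_)
import Data.Bool.Properties as BoolP
open import Data.Fin using (Fin)
open import Data.Fin.Subset using (Subset; _∩_; _∪_; ∁; ⁅_⁆; ⊥)
  renaming (_∈_ to _∈ₛ_)
open import Data.Vec using (Vec; []; _∷_; lookup; tabulate)
open import Data.Vec.Properties using (≡-dec)
open import Data.List using (List; []; _∷_; _++_; map; length; deduplicate; allFin; concatMap)
open import Data.Bool.ListAction using (any)
open import Data.List.Membership.Propositional using (_∈_)
open import Data.List.Relation.Binary.Permutation.Propositional using (_↭_)
open import Data.Rational using (ℚ) renaming (_<_ to _<ℚ_; _≤_ to _≤ℚ_)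
open import Data.Product using (Σ; _×_; _,_)
open import Data.Sum using (_⊎_)
open import Relation.Nullary using (¬_)
open import Relation.Binary.PropositionalEquality using (_≡_; _≢_)
open import Function.Bundles using (_⇔_)

record Graph (n : ℕ) : Set where
  field
    adj   : Fin n → Fin n → Bool
    sym   : ∀ u v → adj u v ≡ adj v u
    irrefl : ∀ v → adj v v ≡ false
open Graph public

-- Trapezoids between two parallel lines (upper interval [a,b],
-- lower interval [c,d]); endpoints are rationals.

record Trapezoid : Set where
  field
    a b c d : ℚ
    a≤b : a ≤ℚ b
    c≤d : c ≤ℚ d
open Trapezoid public

StrictlyLeft : Trapezoid → Trapezoid → Set
StrictlyLeft t s = (b t <ℚ a s) × (d t <ℚ c s)

-- Two (closed) trapezoids intersect iff neither lies strictly left of the other.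
Intersect : Trapezoid → Trapezoid → Set
Intersect t s = ¬ (StrictlyLeft t s ⊎ StrictlyLeft s t)

IsTrapezoidGraph : ∀ {n} → Graph n → Set
IsTrapezoidGraph {n} G =
  Σ (Fin n → Trapezoid) λ rep →
    ∀ u v → u ≢ v → (adj G u v ≡ true) ⇔ Intersect (rep u) (rep v)

nbhdUnion : ∀ {n} → Graph n → Subset n → Subset n
nbhdUnion {n} G X = tabulate λ v → any (λ x → lookup X x ∧ adj G x v) (allFin n)

allSubsets : ∀ n → List (Subset n)
allSubsets zero = [] ∷ []
allSubsets (suc n) = map (true ∷_) (allSubsets n) ++ map (false ∷_) (allSubsets n)

cutFamily : ∀ {n} → Graph n → Subset n → List (Subset n)
cutFamily {n} G A =
  deduplicate (≡-dec BoolP._≟_)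
    (map (λ X → ∁ A ∩ nbhdUnion G (X ∩ A)) (allSubsets n))

-- 2^{cut-bool(A)} = number of distinct sets in the family above
cutBoolCount : ∀ {n} → Graph n → Subset n → ℕ
cutBoolCount G A = length (cutFamily G A)

-- Decomposition trees, encoded as rooted full binary trees whose leaves
-- are labelled by vertices (rooting the cubic tree by subdividing an edge).
-- The cuts of the unrooted tree are exactly the leaf sets of the subtrees
-- at non-root nodes.

data BTree (n : ℕ) : Set where
  leaf : Fin n → BTree n
  node : BTree n → BTree n → BTree n

leaves : ∀ {n} → BTree n → List (Fin n)
leaves (leaf v) = v ∷ []
leaves (node l r) = leaves l ++ leaves r

-- δ is a bijection between V(G) and the leaves
IsDecompositionTree : ∀ {n} → BTree n → Set
IsDecompositionTree {n} t = leaves t ↭ allFin n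

toSubset : ∀ {n} → List (Fin n) → Subset n
toSubset [] = ⊥
toSubset (v ∷ vs) = ⁅ v ⁆ ∪ toSubset vs

subtrees : ∀ {n} → BTree n → List (BTree n)
subtrees (leaf v) = leaf v ∷ []
subtrees (node l r) = node l r ∷ (subtrees l ++ subtrees r)

cuts : ∀ {n} → BTree n → List (Subset n)
cuts (leaf v) = []
cuts (node l r) = map (λ s → toSubset (leaves s)) (subtrees l ++ subtrees r)

-- boolean-width of (T,δ) ≤ log₂ k, i.e. for every cut {A, Ā} both sides have at most k distinct
-- neighbourhood traces
BoolwOfTreeAtMostLog : ∀ {n} → Graph n → BTree n → ℕ → Set
BoolwOfTreeAtMostLog G t k = ∀ A → A ∈ cuts t → cutBoolCount G A ≤ k × cutBoolCount G (∁ A) ≤ k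

-- boolw(G) ≤ log₂ k
BoolwAtMostLog : ∀ {n} → Graph n → ℕ → Set
BoolwAtMostLog {n} G k =
  Σ (BTree n) λ t → IsDecompositionTree t × BoolwOfTreeAtMostLog G t k

module Submission where

-- Give each trapezoid the key b + d (sum of its right endpoints).  If t lies
-- strictly left of s then key t < key s, so when key x ≤ key v the trapezoids
-- of x and v meet iff not (b x < a v and d x < c v).  Across a cut whose side
-- A holds the larger keys, v ∈ A therefore misses all of X ⊆ Ā iff
-- max b(X) < a v and max d(X) < c v: the trace of X equals the trace of its
-- two maximisers.  Negating all coordinates gives the same for X ⊆ A.
--
-- The
-- theorem takes the caterpillar over the vertices sorted by key.

open import Defs hiding (sym)
import Data.Nat as ℕ
open import Data.Nat using (ℕ; zero; suc; _≤_; _^_; _*_; z≤n; s≤s)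
open import Data.Nat.Properties using (*-identityʳ)
open import Data.Bool using (true)
open import Data.Bool.Properties using (T-≡; T-∧) renaming (_≟_ to _≟ᵇ_)
open import Data.Fin using (Fin)
open import Data.Fin.Subset using (Subset; _∩_; _∪_; ∁; ⁅_⁆; _∈_; _∉_; _⊆_; Nonempty)
open import Data.Fin.Subset.Properties
  using (_∈?_; nonempty?; ⊆-antisym; x∈⁅x⁆; x∈⁅y⁆⇒x≡y; x∈p∩q⁺; x∈p∩q⁻; x∈p∪q⁺; x∈p∪q⁻;
         x∈∁p⇒x∉p; x∉∁p⇒x∈p; x∉p⇒x∈∁p; ∉⊥)
open import Data.Vec.Properties using (≡-dec; lookup∘tabulate; []=⇒lookup; lookup⇒[]=)
open import Data.List using (List; []; _∷_; _++_; [_]; map; length; allFin; filter; cartesianProductWith)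
open import Data.List.Properties using (length-++; length-map; length-tabulate)
open import Data.List.Membership.Propositional using (lose) renaming (_∈_ to _∈ₗ_)
open import Data.List.Membership.Propositional.Properties
  using (∈-allFin; ∈-map⁻; ∈-deduplicate⁻; ∈-cartesianProductWith⁺; ∈-∃++; ∈-filter⁺; ∈-filter⁻; ∈-++⁻; ∈-++⁺ʳ)
open import Data.List.Relation.Unary.Any using (here; there; satisfied)
open import Data.List.Relation.Unary.Any.Properties using (any⁺; any⁻; singleton⁻)
open import Data.List.Relation.Unary.All as All using ()
open import Data.List.Relation.Unary.AllPairs using (AllPairs; _∷_)
open import Data.List.Relation.Unary.Linked.Properties using (Linked⇒AllPairs)
open import Data.List.Relation.Unary.Unique.Propositional using (Unique; _∷_)
open import Data.List.Relation.Unary.Unique.DecPropositional.Properties using (deduplicate-!)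
open import Data.List.Relation.Binary.Permutation.Propositional using (_↭_; ↭-sym)
open import Data.List.Relation.Binary.Permutation.Propositional.Properties
  using (↭-length; ∈-resp-↭; shift)
import Data.List.Sort as Sorting
import Data.List.Extrema as Extrema
open import Data.Rational using (ℚ; -_; _+_)
  renaming (_<_ to _<ℚ_; _≤_ to _≤ℚ_; _<?_ to _<ℚ?_)
open import Data.Rational.Properties
  using (≤-decTotalOrder; ≤-trans; <-irrefl; <-≤-trans; ≤-<-trans; <⇒≤; +-mono-<-≤; neg-antimono-<; +-0-group)
open import Algebra.Properties.Group +-0-group using (⁻¹-involutive)
open import Data.Product using (∃; ∃₂; _×_; _,_; proj₁; proj₂)
open import Data.Sum using (_⊎_; inj₁; inj₂)
open import Data.Empty using (⊥-elim)
open import Function using (_∘_)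
open import Function.Bundles using (_⇔_; mk⇔; Equivalence)
open import Function.Construct.Composition using (_⇔-∘_)
open import Function.Related.TypeIsomorphisms using (¬-cong-⇔)
open import Relation.Binary.Bundles using (DecTotalOrder)
import Relation.Binary.Construct.On as On
open import Relation.Nullary using (¬_; yes; no)
open import Relation.Binary.PropositionalEquality
  using (_≡_; _≢_; refl; sym; trans; cong; cong₂; subst; subst₂)

unique-⊆-length : ∀ {A : Set} {xs ys : List A} → Unique xs →
  (∀ {z} → z ∈ₗ xs → z ∈ₗ ys) → length xs ≤ length ys
unique-⊆-length {xs = []} _ _ = z≤n
unique-⊆-length {xs = x ∷ xs} (x∉xs ∷ unique) xs⊆ys
  with as , bs , refl ← ∈-∃++ (xs⊆ys (here refl)) =
  subst (suc (length xs) ≤_) (sym (↭-length (shift x as bs)))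
    (s≤s (unique-⊆-length unique xs⊆as++bs))
  where
  -- removing the occurrence of x keeps the rest of xs, as x ∉ xs
  xs⊆as++bs : ∀ {z} → z ∈ₗ xs → z ∈ₗ as ++ bs
  xs⊆as++bs z∈xs with ∈-resp-↭ (shift x as bs) (xs⊆ys (there z∈xs))
  ... | here refl = ⊥-elim (All.lookup x∉xs z∈xs refl)
  ... | there z∈as++bs = z∈as++bs

length-cartesianProductWith : ∀ {A B C : Set} (f : A → B → C) (xs : List A) (ys : List B) →
  length (cartesianProductWith f xs ys) ≡ length xs * length ys
length-cartesianProductWith f [] ys = refl
length-cartesianProductWith f (x ∷ xs) ys =
  trans (length-++ (map (f x) ys))
        (cong₂ ℕ._+_ (length-map (f x) ys) (length-cartesianProductWith f xs ys))

length-allFin : ∀ n → length (allFin n) ≡ n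
length-allFin n = length-tabulate {n = n} (λ i → i)

-- The set {p, q}; p = q is allowed, so this covers sets of one or two vertices.
pair : ∀ {n} → Fin n → Fin n → Subset n
pair p q = ⁅ p ⁆ ∪ ⁅ q ⁆

∈-pairˡ : ∀ {n} (p q : Fin n) → p ∈ pair p q
∈-pairˡ p q = x∈p∪q⁺ (inj₁ (x∈⁅x⁆ p))

∈-pairʳ : ∀ {n} (p q : Fin n) → q ∈ pair p q
∈-pairʳ p q = x∈p∪q⁺ (inj₂ (x∈⁅x⁆ q))

∈-pair⁻ : ∀ {n} {x : Fin n} (p q : Fin n) → x ∈ pair p q → x ≡ p ⊎ x ≡ q
∈-pair⁻ p q x∈pq with x∈p∪q⁻ ⁅ p ⁆ ⁅ q ⁆ x∈pq
... | inj₁ x∈p = inj₁ (x∈⁅y⁆⇒x≡y p x∈p)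
... | inj₂ x∈q = inj₂ (x∈⁅y⁆⇒x≡y q x∈q)

∈-pair-diagonal : ∀ {n} {x : Fin n} (p : Fin n) → x ∈ pair p p → x ≡ p
∈-pair-diagonal p x∈pp with ∈-pair⁻ p p x∈pp
... | inj₁ x≡p = x≡p
... | inj₂ x≡p = x≡p

-- The trace of X across the cut {A, Ā}: the vertices of Ā adjacent to X ∩ A.
-- cutFamily G A is the list of all traces, so cutBoolCount counts them.
trace : ∀ {n} → Graph n → Subset n → Subset n → Subset n
trace G A X = ∁ A ∩ nbhdUnion G (X ∩ A)

TwoGenerated : ∀ {n} → Graph n → Subset n → Set
TwoGenerated G A = ∀ X → ∃₂ λ p q → trace G A X ≡ trace G A (pair p q)

-- A two-generated cut has at most n · n distinct traces, as they all occur
-- in the list of traces of the n · n pairs.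
cutBoolCount≤ : ∀ {n} (G : Graph n) (A : Subset n) → TwoGenerated G A →
  cutBoolCount G A ≤ n * n
cutBoolCount≤ {n} G A twoGenerated =
  subst (cutBoolCount G A ≤_) pairTraces-length
    (unique-⊆-length (deduplicate-! (≡-dec _≟ᵇ_) _) traces⊆pairTraces)
  where
  pairTraces : List (Subset n)
  pairTraces = cartesianProductWith (λ p q → trace G A (pair p q)) (allFin n) (allFin n)

  pairTraces-length : length pairTraces ≡ n * n
  pairTraces-length = trans (length-cartesianProductWith _ (allFin n) (allFin n))
                            (cong₂ _*_ (length-allFin n) (length-allFin n))

  traces⊆pairTraces : ∀ {S} → S ∈ₗ cutFamily G A → S ∈ₗ pairTraces
  traces⊆pairTraces S∈traces
    with X , _ , refl ← ∈-map⁻ (trace G A) (∈-deduplicate⁻ (≡-dec _≟ᵇ_) _ S∈traces)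
    with p , q , trace≡ ← twoGenerated X
    rewrite trace≡ = ∈-cartesianProductWith⁺ _ (∈-allFin p) (∈-allFin q)

∈-nbhdUnion⁻ : ∀ {n} (G : Graph n) {Y : Subset n} {v} → v ∈ nbhdUnion G Y →
  ∃ λ y → y ∈ Y × adj G y v ≡ true
∈-nbhdUnion⁻ {n} G {Y} {v} v∈N
  with y , y∈Y∧yv ← satisfied (any⁻ _ (allFin n) (Equivalence.from T-≡
                       (trans (sym (lookup∘tabulate _ v)) ([]=⇒lookup v∈N))))
  with Ty∈Y , Tyv ← Equivalence.to T-∧ y∈Y∧yv =
  y , lookup⇒[]= y Y (Equivalence.to T-≡ Ty∈Y) , Equivalence.to T-≡ Tyv

∈-nbhdUnion⁺ : ∀ {n} (G : Graph n) {Y : Subset n} {y v} → y ∈ Y → adj G y v ≡ true →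
  v ∈ nbhdUnion G Y
∈-nbhdUnion⁺ {n} G {Y} {y} {v} y∈Y yv =
  lookup⇒[]= v (nbhdUnion G Y) (trans (lookup∘tabulate _ v) (Equivalence.to T-≡ anyTrue))
  where
  anyTrue = any⁺ _ (lose (∈-allFin y)
              (Equivalence.from T-∧ (Equivalence.from T-≡ ([]=⇒lookup y∈Y) , Equivalence.from T-≡ yv)))

Sees : ∀ {n} → Graph n → Subset n → Subset n → Fin n → Set
Sees G A X v = ∃ λ x → x ∈ X × x ∈ A × adj G x v ≡ true

Covers : ∀ {n} → Graph n → Subset n → Subset n → Subset n → Set
Covers G A X Y = ∀ {v} → v ∉ A → Sees G A Y v → Sees G A X v

Silent : ∀ {n} → Graph n → Subset n → Subset n → Set
Silent G A X = ∀ {v} → v ∉ A → ¬ Sees G A X v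

trace-⊆ : ∀ {n} (G : Graph n) {A X Y : Subset n} → Covers G A X Y → trace G A Y ⊆ trace G A X
trace-⊆ G {A} {X} {Y} XcoversY v∈traceY
  with v∈∁A , v∈NY ← x∈p∩q⁻ (∁ A) _ v∈traceY
  with y , y∈Y∩A , yv ← ∈-nbhdUnion⁻ G v∈NY
  with y∈Y , y∈A ← x∈p∩q⁻ Y A y∈Y∩A
  with x , x∈X , x∈A , xv ← XcoversY (x∈∁p⇒x∉p v∈∁A) (y , y∈Y , y∈A , yv) =
  x∈p∩q⁺ (v∈∁A , ∈-nbhdUnion⁺ G (x∈p∩q⁺ (x∈X , x∈A)) xv)

trace-≡ : ∀ {n} (G : Graph n) {A X Y : Subset n} →
  Covers G A X Y → Covers G A Y X → trace G A X ≡ trace G A Y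
trace-≡ G XcoversY YcoversX = ⊆-antisym (trace-⊆ G YcoversX) (trace-⊆ G XcoversY)

covers-⊆ : ∀ {n} (G : Graph n) {A X Y : Subset n} →
  (∀ {y} → y ∈ Y → y ∈ A → y ∈ X) → Covers G A X Y
covers-⊆ G Y∩A⊆X _ (y , y∈Y , y∈A , yv) = y , Y∩A⊆X y∈Y y∈A , y∈A , yv

covers-silent : ∀ {n} (G : Graph n) {A X Y : Subset n} → Silent G A Y → Covers G A X Y
covers-silent G silent v∉A sees = ⊥-elim (silent v∉A sees)

-- The silent trace (the empty one) is the trace of a single vertex: one
-- outside A if there is such, and any vertex z otherwise.
silent-trace : ∀ {n} (G : Graph n) (A : Subset n) {X : Subset n} → Fin n →
  Silent G A X → ∃₂ λ p q → trace G A X ≡ trace G A (pair p q)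
silent-trace G A {X} z silentX with nonempty? (∁ A)
... | yes (p , p∈∁A) =
  p , p , trace-≡ G (covers-silent G silentPair) (covers-silent G silentX)
  where
  silentPair : Silent G A (pair p p)
  silentPair _ (x , x∈pp , x∈A , _) =
    x∈∁p⇒x∉p p∈∁A (subst (_∈ A) (∈-pair-diagonal p x∈pp) x∈A)
... | no ∁A-empty =
  z , z , trace-≡ G {A} {X} {pair z z}
              (covers-silent G nothingOutside) (covers-silent G nothingOutside)
  where
  nothingOutside : ∀ {Y} → Silent G A Y
  nothingOutside {v = v} v∉A _ = ∁A-empty (v , x∉p⇒x∈∁p v∉A)

-- A cut side with at most one vertex w is two-generated: X ∩ A is {w} or empty.
twoGenerated-atMostOne : ∀ {n} (G : Graph n) (A : Subset n) (w : Fin n) →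
  (∀ {x} → x ∈ A → x ≡ w) → TwoGenerated G A
twoGenerated-atMostOne G A w onlyW X with w ∈? X
... | yes w∈X = w , w , trace-≡ G (covers-⊆ G toX) (covers-⊆ G toPair)
  where
  toPair : ∀ {y} → y ∈ X → y ∈ A → y ∈ pair w w
  toPair _ y∈A rewrite onlyW y∈A = ∈-pairˡ w w
  toX : ∀ {y} → y ∈ pair w w → y ∈ A → y ∈ X
  toX _ y∈A rewrite onlyW y∈A = w∈X
... | no w∉X = silent-trace G A w silentX
  where
  silentX : Silent G A X
  silentX _ (x , x∈X , x∈A , _) rewrite onlyW x∈A = w∉X x∈X

-- A cut whose other side is at most one vertex w is two-generated: X ∩ A
-- either sees w, and then so does a single vertex of it, or it is silent.
twoGenerated-coAtMostOne : ∀ {n} (G : Graph n) (A : Subset n) (w : Fin n) →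
  (∀ {v} → v ∉ A → v ≡ w) → TwoGenerated G A
twoGenerated-coAtMostOne G A w onlyW X with w ∈? nbhdUnion G (X ∩ A)
... | yes w∈N with x , x∈X∩A , xw ← ∈-nbhdUnion⁻ G w∈N with x∈X , x∈A ← x∈p∩q⁻ X A x∈X∩A =
  x , x , trace-≡ G (covers-⊆ G toX) seenByPair
  where
  seenByPair : Covers G A (pair x x) X
  seenByPair v∉A _ rewrite onlyW v∉A = x , ∈-pairˡ x x , x∈A , xw
  toX : ∀ {y} → y ∈ pair x x → y ∈ A → y ∈ X
  toX y∈xx _ = subst (_∈ X) (sym (∈-pair-diagonal x y∈xx)) x∈X
... | no w∉N = silent-trace G A w silentX
  where
  silentX : Silent G A X
  silentX v∉A (x , x∈X , x∈A , xv) rewrite onlyW v∉A =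
    w∉N (∈-nbhdUnion⁺ G (x∈p∩q⁺ (x∈X , x∈A)) xv)

members : ∀ {n} → Subset n → List (Fin n)
members {n} S = filter (_∈? S) (allFin n)

∈-members⁺ : ∀ {n} {S : Subset n} {x} → x ∈ S → x ∈ₗ members S
∈-members⁺ {S = S} x∈S = ∈-filter⁺ (_∈? S) (∈-allFin _) x∈S

∈-members⁻ : ∀ {n} {S : Subset n} {x} → x ∈ₗ members S → x ∈ S
∈-members⁻ {n} {S} x∈ = proj₂ (∈-filter⁻ (_∈? S) {xs = allFin n} x∈)

maximiser : ∀ {n} (f : Fin n → ℚ) (S : Subset n) → Nonempty S →
  ∃ λ p → p ∈ S × (∀ {x} → x ∈ S → f x ≤ℚ f p)
maximiser f S (m , m∈S) = best , best∈S , greatest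
  where
  open Extrema (DecTotalOrder.totalOrder ≤-decTotalOrder)
  best = argmax f m (members S)
  best∈S : best ∈ S
  best∈S = argmax-all f m∈S (All.tabulate ∈-members⁻)
  greatest : ∀ {x} → x ∈ S → f x ≤ℚ f best
  greatest x∈S = All.lookup (f[xs]≤f[argmax] m (members S)) (∈-members⁺ x∈S)

ThresholdCut : ∀ {n} → Graph n → Subset n → (α β γ δ : Fin n → ℚ) → Set
ThresholdCut G A α β γ δ =
  ∀ {x v} → x ∈ A → v ∉ A → adj G x v ≡ true ⇔ (¬ (α x <ℚ β v × γ x <ℚ δ v))

-- A threshold cut is two-generated: if X ∩ A is nonempty, its trace is that
-- of {p, q}, where p maximises α and q maximises γ on X ∩ A.  (z is any
-- vertex, needed only for the empty trace.)
twoGenerated-threshold : ∀ {n} (G : Graph n) (A : Subset n) {α β γ δ : Fin n → ℚ} →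
  Fin n → ThresholdCut G A α β γ δ → TwoGenerated G A
twoGenerated-threshold G A {α} {β} {γ} {δ} z threshold X with nonempty? (X ∩ A)
... | no X∩A-empty =
  silent-trace G A z λ _ (x , x∈X , x∈A , _) → X∩A-empty (x , x∈p∩q⁺ (x∈X , x∈A))
... | yes X∩A-nonempty
  with p , p∈X∩A , α≤αp ← maximiser α (X ∩ A) X∩A-nonempty
     | q , q∈X∩A , γ≤γq ← maximiser γ (X ∩ A) X∩A-nonempty =
  p , q , trace-≡ G (covers-⊆ G toX) maximisersSee
  where
  p∈A = proj₂ (x∈p∩q⁻ X A p∈X∩A)
  q∈A = proj₂ (x∈p∩q⁻ X A q∈X∩A)

  toX : ∀ {y} → y ∈ pair p q → y ∈ A → y ∈ X
  toX y∈pq _ with ∈-pair⁻ p q y∈pq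
  ... | inj₁ refl = proj₁ (x∈p∩q⁻ X A p∈X∩A)
  ... | inj₂ refl = proj₁ (x∈p∩q⁻ X A q∈X∩A)

  -- if v were missed by both maximisers, it would be missed by all of X ∩ A
  maximisersSee : Covers G A (pair p q) X
  maximisersSee {v} v∉A (y , y∈X , y∈A , yv) with α p <ℚ? β v | γ q <ℚ? δ v
  ... | yes αp<βv | yes γq<δv =
    ⊥-elim (Equivalence.to (threshold y∈A v∉A) yv
             ( ≤-<-trans (α≤αp (x∈p∩q⁺ (y∈X , y∈A))) αp<βv
             , ≤-<-trans (γ≤γq (x∈p∩q⁺ (y∈X , y∈A))) γq<δv))
  ... | no αp≮βv | _ =
    p , ∈-pairˡ p q , p∈A , Equivalence.from (threshold p∈A v∉A) (αp≮βv ∘ proj₁)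
  ... | yes _ | no γq≮δv =
    q , ∈-pairʳ p q , q∈A , Equivalence.from (threshold q∈A v∉A) (γq≮δv ∘ proj₂)

key : Trapezoid → ℚ
key t = b t + d t

strictlyLeft⇒key< : ∀ t s → StrictlyLeft t s → key t <ℚ key s
strictlyLeft⇒key< t s (bt<as , dt<cs) =
  +-mono-<-≤ (<-≤-trans bt<as (a≤b s)) (<⇒≤ (<-≤-trans dt<cs (c≤d s)))

-- If key t ≤ key s, then s cannot lie strictly left of t, so the two meet
-- unless t lies strictly left of s.
intersect-ordered : ∀ t s → key t ≤ℚ key s → Intersect t s ⇔ (¬ StrictlyLeft t s)
intersect-ordered t s kt≤ks = mk⇔ (λ meet tLeft → meet (inj₁ tLeft)) apart⇒meet
  where
  apart⇒meet : ¬ StrictlyLeft t s → Intersect t s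
  apart⇒meet tNotLeft (inj₁ tLeft) = tNotLeft tLeft
  apart⇒meet _ (inj₂ sLeft) = <-irrefl refl (<-≤-trans (strictlyLeft⇒key< s t sLeft) kt≤ks)

neg-cancel-< : ∀ {p q} → - p <ℚ - q → q <ℚ p
neg-cancel-< {p} {q} -p<-q = subst₂ _<ℚ_ (⁻¹-involutive q) (⁻¹-involutive p) (neg-antimono-< -p<-q)

strictlyLeft-mirror : ∀ t s → StrictlyLeft t s ⇔ ((- a s <ℚ - b t) × (- c s <ℚ - d t))
strictlyLeft-mirror t s =
  mk⇔ (λ (bt<as , dt<cs) → neg-antimono-< bt<as , neg-antimono-< dt<cs)
      (λ (-as<-bt , -cs<-dt) → neg-cancel-< -as<-bt , neg-cancel-< -cs<-dt)

Realises : ∀ {n} → Graph n → (Fin n → Trapezoid) → Set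
Realises G rep = ∀ u v → u ≢ v → (adj G u v ≡ true) ⇔ Intersect (rep u) (rep v)

RightSide : ∀ {n} → (Fin n → Trapezoid) → Subset n → Set
RightSide rep A = ∀ {x v} → x ∉ A → v ∈ A → key (rep x) ≤ℚ key (rep v)

member≢outsider : ∀ {n} {B : Subset n} {x v} → x ∈ B → v ∉ B → x ≢ v
member≢outsider x∈B v∉B refl = v∉B x∈B

threshold-leftSide : ∀ {n} (G : Graph n) (rep : Fin n → Trapezoid) (A : Subset n) →
  Realises G rep → RightSide rep A →
  ThresholdCut G (∁ A) (b ∘ rep) (a ∘ rep) (d ∘ rep) (c ∘ rep)
threshold-leftSide G rep A realises rightSide {x} {v} x∈∁A v∉∁A =
  intersect-ordered (rep x) (rep v) (rightSide (x∈∁p⇒x∉p x∈∁A) (x∉∁p⇒x∈p v∉∁A))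
    ⇔-∘ realises x v (member≢outsider x∈∁A v∉∁A)

threshold-rightSide : ∀ {n} (G : Graph n) (rep : Fin n → Trapezoid) (A : Subset n) →
  Realises G rep → RightSide rep A →
  ThresholdCut G A (-_ ∘ a ∘ rep) (-_ ∘ b ∘ rep) (-_ ∘ c ∘ rep) (-_ ∘ d ∘ rep)
threshold-rightSide G rep A realises rightSide {x} {v} x∈A v∉A =
  ¬-cong-⇔ (strictlyLeft-mirror (rep v) (rep x))
    ⇔-∘ (intersect-ordered (rep v) (rep x) (rightSide v∉A x∈A)
    ⇔-∘ (realises v x (member≢outsider x∈A v∉A ∘ sym)
    ⇔-∘ adj-sym))
  where
  adj-sym : adj G x v ≡ true ⇔ adj G v x ≡ true
  adj-sym = mk⇔ (trans (Graph.sym G v x)) (trans (Graph.sym G x v))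

comb : ∀ {n} → Fin n → List (Fin n) → BTree n
comb v [] = leaf v
comb v (w ∷ ws) = node (leaf v) (comb w ws)

leaves-comb : ∀ {n} (v : Fin n) vs → leaves (comb v vs) ≡ v ∷ vs
leaves-comb v [] = refl
leaves-comb v (w ∷ ws) = cong (v ∷_) (leaves-comb w ws)

subtree-comb : ∀ {n} (v : Fin n) vs {s} → s ∈ₗ subtrees (comb v vs) →
  (∃ λ P → P ++ leaves s ≡ v ∷ vs) ⊎ (∃ λ w → s ≡ leaf w)
subtree-comb v [] (here refl) = inj₂ (v , refl)
subtree-comb v (w ∷ ws) (here refl) = inj₁ ([] , cong (v ∷_) (leaves-comb w ws))
subtree-comb v (w ∷ ws) (there (here refl)) = inj₂ (v , refl)
subtree-comb v (w ∷ ws) (there (there s∈)) with subtree-comb w ws s∈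
... | inj₁ (P , suffix) = inj₁ (v ∷ P , cong (v ∷_) suffix)
... | inj₂ isLeaf = inj₂ isLeaf

cut-subtree : ∀ {n} (t : BTree n) {A} → A ∈ₗ cuts t →
  ∃ λ s → s ∈ₗ subtrees t × A ≡ toSubset (leaves s)
cut-subtree (node l r) A∈cuts with s , s∈ , refl ← ∈-map⁻ (toSubset ∘ leaves) A∈cuts =
  s , there s∈ , refl

∈-toSubset⁻ : ∀ {n} (vs : List (Fin n)) {x} → x ∈ toSubset vs → x ∈ₗ vs
∈-toSubset⁻ [] x∈⊥ = ⊥-elim (∉⊥ x∈⊥)
∈-toSubset⁻ (v ∷ vs) x∈ with x∈p∪q⁻ ⁅ v ⁆ (toSubset vs) x∈
... | inj₁ x∈v = here (x∈⁅y⁆⇒x≡y v x∈v)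
... | inj₂ x∈vs = there (∈-toSubset⁻ vs x∈vs)

∈-toSubset⁺ : ∀ {n} (vs : List (Fin n)) {x} → x ∈ₗ vs → x ∈ toSubset vs
∈-toSubset⁺ (v ∷ vs) (here refl) = x∈p∪q⁺ (inj₁ (x∈⁅x⁆ v))
∈-toSubset⁺ (v ∷ vs) (there x∈vs) = x∈p∪q⁺ (inj₂ (∈-toSubset⁺ vs x∈vs))

allPairs-prefix-suffix : ∀ {A : Set} {R : A → A → Set} (P : List A) {Q : List A} →
  AllPairs R (P ++ Q) → ∀ {x v} → x ∈ₗ P → v ∈ₗ Q → R x v
allPairs-prefix-suffix (y ∷ P) (y≤rest ∷ _) (here refl) v∈Q = All.lookup y≤rest (∈-++⁺ʳ P v∈Q)
allPairs-prefix-suffix (y ∷ P) (_ ∷ sorted) (there x∈P) v∈Q = allPairs-prefix-suffix P sorted x∈P v∈Q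

KeySorted : ∀ {n} → (Fin n → Trapezoid) → List (Fin n) → Set
KeySorted rep = AllPairs (λ x y → key (rep x) ≤ℚ key (rep y))

-- The comb over a key-sorted enumeration of the vertices has at most n · n
-- traces on both sides of every cut: a suffix cut is a threshold cut from
-- either side, and a leaf cut has a side of size one.
comb-boolw : ∀ {n} (G : Graph n) (rep : Fin n → Trapezoid) → Realises G rep →
  ∀ v vs → (v ∷ vs) ↭ allFin n → KeySorted rep (v ∷ vs) →
  BoolwOfTreeAtMostLog G (comb v vs) (n * n)
comb-boolw G rep realises v vs enumerates sorted A A∈cuts
  with s , s∈ , refl ← cut-subtree (comb v vs) A∈cuts
  with subtree-comb v vs s∈
... | inj₁ (P , split) =
    cutBoolCount≤ G _ (twoGenerated-threshold G _ v (threshold-rightSide G rep _ realises rightSide))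
  , cutBoolCount≤ G _ (twoGenerated-threshold G _ v (threshold-leftSide G rep _ realises rightSide))
  where
  -- every vertex lies in P ++ leaves s, and P carries the smaller keys
  inPrefix : ∀ {x} → x ∉ toSubset (leaves s) → x ∈ₗ P
  inPrefix {x} x∉s
    with ∈-++⁻ P (subst (x ∈ₗ_) (sym split) (∈-resp-↭ (↭-sym enumerates) (∈-allFin x)))
  ... | inj₁ x∈P = x∈P
  ... | inj₂ x∈s = ⊥-elim (x∉s (∈-toSubset⁺ (leaves s) x∈s))

  rightSide : RightSide rep (toSubset (leaves s))
  rightSide x∉s w∈s =
    allPairs-prefix-suffix P (subst (KeySorted rep) (sym split) sorted)
      (inPrefix x∉s) (∈-toSubset⁻ (leaves s) w∈s)
... | inj₂ (w , refl) =
    cutBoolCount≤ G _ (twoGenerated-atMostOne G _ w onlyW)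
  , cutBoolCount≤ G _ (twoGenerated-coAtMostOne G _ w (onlyW ∘ x∉∁p⇒x∈p))
  where
  onlyW : ∀ {x} → x ∈ toSubset [ w ] → x ≡ w
  onlyW x∈w = singleton⁻ (∈-toSubset⁻ [ w ] x∈w)

module KeySort {n : ℕ} (rep : Fin n → Trapezoid) =
  Sorting (On.decTotalOrder ≤-decTotalOrder (key ∘ rep))

keySortedEnumeration : ∀ {m} (rep : Fin (suc m) → Trapezoid) →
  ∃₂ λ v vs → (v ∷ vs) ↭ allFin (suc m) × KeySorted rep (v ∷ vs)
keySortedEnumeration {m} rep
  with KeySort.sort rep (allFin (suc m))
     | KeySort.sort-↭ rep (allFin (suc m))
     | KeySort.sort-↗ rep (allFin (suc m))
... | [] | enumerates | _ with () ← ∈-resp-↭ (↭-sym enumerates) (∈-allFin Fin.zero)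
... | v ∷ vs | enumerates | sorted = v , vs , enumerates , Linked⇒AllPairs ≤-trans sorted

n*n≡n^2 : ∀ n → n * n ≡ n ^ 2
n*n≡n^2 n = cong (n *_) (sym (*-identityʳ n))

mainTheorem16 : (n : ℕ) → 1 ≤ n → (G : Graph n) → IsTrapezoidGraph G →
    BoolwAtMostLog G (n ^ 2)
mainTheorem16 zero () G _
mainTheorem16 n@(suc _) _ G (rep , realises)
  with v , vs , enumerates , sorted ← keySortedEnumeration rep =
  comb v vs ,
  subst (_↭ allFin n) (sym (leaves-comb v vs)) enumerates ,
  subst (BoolwOfTreeAtMostLog G (comb v vs)) (n*n≡n^2 n)
    (comb-boolw G rep realises v vs enumerates sorted)
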